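{- Let $n,m$ be positive integers, let ${\cal P}$ be a hereditary graph class with ${\cal P}\subseteq Free(K_n)$ and let ${\cal Q}$ be a hereditary graph class with ${\cal Q}\subseteq Free(\overline{K}_m)$. Then there exists a constant $\tau=\tau({\cal P},{\cal Q})$ such that for every graph $G=(V,E)\in{\cal P}\circ{\cal Q}$ and every subset $B\subseteq V$ with $G[B]\in{\cal P}$, at least one of the following holds: (a) there is a subset $A\subseteq V$ such that $G[A]\in{\cal P}$, $G[V-A]\in{\cal Q}$, and $|A-B|\le\tau$; (b) there is a subset $C\subseteq V$ such that $G[C]\in{\cal P}$, $|C|=|B|+1$, and $|B-C|\le\tau$.
   Context: Graphs are finite and simple. $K_n$ is the complete graph on $n$ vertices and $\overline{K}_m$ is the edgeless graph on $m$ vertices. $Free(Y)$ denotes the class of graphs containing no induced subgraph isomorphic to a graph in $Y$. A class is hereditary if it is closed under deleting vertices. $G[U]$ is the subgraph induced by $U$. ${\cal P}\circ{\cal Q}$ is the class of graphs $G$ whose vertex set can be partitioned into sets $V_1,V_2$ (possibly empty) with $G[V_1]\in{\cal P}$ and $G[V_2]\in{\cal Q}$. -}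

module Defs where

open import Data.Nat using (ℕ; zero; suc)
open import Data.Bool using (Bool; true; false; not)
open import Data.Fin using (Fin)
open import Data.Fin.Properties using (_≟_)
open import Data.Fin.Subset using (Subset; _∈_; ∁)
open import Data.Product using (Σ; ∃; _×_)
open import Relation.Nullary using (¬_; does)
open import Relation.Binary.PropositionalEquality using (_≡_)
open import Function.Definitions using (Injective)
open import Function.Bundles using (_⇔_)
open import Level using (suc; zero) renaming (Level to Lvl)

record Graph (n : ℕ) : Set where
  field
    adj     : Fin n → Fin n → Bool
    adj-sym : ∀ i j → adj i j ≡ adj j i
    adj-irr : ∀ i → adj i i ≡ false
open Graph public

GraphClass : Set₁
GraphClass = ∀ {n} → Graph n → Set

InducedEmbedding : ∀ {k n} → Graph k → Graph n → (Fin k → Fin n) → Set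
InducedEmbedding H G f =
  Injective _≡_ _≡_ f × (∀ i j → adj H i j ≡ adj G (f i) (f j))

Hereditary : GraphClass → Set
Hereditary P = ∀ {k n} (H : Graph k) (G : Graph n) (f : Fin k → Fin n) →
  InducedEmbedding H G f → P G → P H

K : (n : ℕ) → Graph n
K n = record { adj = λ i j → not (does (i ≟ j))
             ; adj-sym = sym'
             ; adj-irr = irr }
  where
  open import Relation.Binary.PropositionalEquality using (refl; sym)
  open import Relation.Nullary using (yes; no)
  sym' : ∀ i j → not (does (i ≟ j)) ≡ not (does (j ≟ i))
  sym' i j with i ≟ j | j ≟ i
  ... | yes _ | yes _ = refl
  ... | yes p | no q = Data.Empty.⊥-elim (q (sym p))
    where import Data.Empty
  ... | no p | yes q = Data.Empty.⊥-elim (p (sym q))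
    where import Data.Empty
  ... | no _ | no _ = refl
  irr : ∀ i → not (does (i ≟ i)) ≡ false
  irr i with i ≟ i
  ... | yes _ = refl
  ... | no p = Data.Empty.⊥-elim (p refl)
    where import Data.Empty

Edgeless : (m : ℕ) → Graph m
Edgeless m = record { adj = λ _ _ → false ; adj-sym = λ _ _ → refl' ; adj-irr = λ _ → refl' }
  where
  open import Relation.Binary.PropositionalEquality using () renaming (refl to refl')

ContainsInduced : ∀ {k n} → Graph n → Graph k → Set
ContainsInduced G H = ∃ λ f → InducedEmbedding H G f

Free : ∀ {k} → Graph k → GraphClass
Free Y G = ¬ ContainsInduced G Y

_⊆C_ : GraphClass → GraphClass → Set
P ⊆C Q = ∀ {n} (G : Graph n) → P G → Q G

-- G[U] ∈ P : the subgraph of G induced by U belongs to P, i.e. some graph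
-- H ∈ P is mapped by an induced embedding bijectively onto U.
InducedIn : GraphClass → ∀ {n} → Graph n → Subset n → Set
InducedIn P {n} G U = Σ ℕ λ k → Σ (Graph k) λ H → Σ (Fin k → Fin n) λ f →
  InducedEmbedding H G f × (∀ x → (x ∈ U) ⇔ (∃ λ i → f i ≡ x)) × P H

-- P ∘ Q : vertex set partitions into V₁, V₂ (possibly empty) with
-- G[V₁] ∈ P and G[V₂] ∈ Q.
_∘C_ : GraphClass → GraphClass → GraphClass
(P ∘C Q) G = ∃ λ U → InducedIn P G U × InducedIn Q G (∁ U)

{-# OPTIONS --safe #-}
module Submission where

open import Defs
open import Data.Nat using (ℕ; suc; _≤_)
open import Data.Fin.Subset using (Subset; ∣_∣; _─_; ∁)
open import Data.Product using (Σ; ∃; _×_)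
open import Data.Sum using (_⊎_)
open import Relation.Binary.PropositionalEquality using (_≡_)

open import Data.Bool using (Bool; true; false)
open import Data.Nat using (zero; _+_; _<_; z≤n; s≤s; s≤s⁻¹; _≤?_)
open import Data.Nat.Properties
  using (≤-trans; ≤-reflexive; ≤-antisym; <⇒≤; ≤-<-connex; ≰⇒>; <-irrefl; n≤1+n;
         +-suc; +-mono-<; +-monoˡ-≤; +-cancelˡ-≤; module ≤-Reasoning)
open import Data.Fin using (Fin) renaming (zero to fzero; suc to fsuc)
open import Data.Fin.Properties using (suc-injective; _≟_)
open import Data.Fin.Subset using (_∈_; _∉_; _⊆_; _∩_; _-_; ⁅_⁆; Nonempty; inside; outside)
open import Data.Fin.Subset.Properties
  using (∩-comm; p∩q⊆p; p∩q⊆q; x∈p∩q⁺; ∣p∩q∣≤∣p∣; ∣p∩q∣≤∣q∣; ∣⁅x⁆∣≡1; x∉⁅y⁆⇒x≢y;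
         x∈p∧x∉q⇒x∈p─q; p─q⊆p; x∉p⇒x∈∁p; p⊆q⇒∣p∣≤∣q∣; drop-∷-⊆; out⊆; in⊆in)
open import Data.Vec using ([]; _∷_; tabulate; here; there)
open import Data.Vec.Properties using (lookup∘tabulate; []=⇒lookup; lookup⇒[]=)
import Data.Vec.Functional as Vector
open import Data.Product using (_,_; proj₁; proj₂)
open import Data.Sum as Sum using (inj₁; inj₂)
open import Data.Empty using (⊥-elim)
open import Relation.Nullary using (¬_; yes; no)
open import Relation.Binary.PropositionalEquality using (_≢_; refl; sym; trans; cong; cong₂; module ≡-Reasoning)
open import Function.Base using (_∘_; id)
open import Function.Definitions using (Injective)
open import Function.Bundles using (_⇔_; mk⇔; Equivalence)

-- Fix a partition (U, ∁ U) witnessing G ∈ P ∘ Q. The set B ─ U induces a graph lying in both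
-- P and Q, so it contains neither K n nor an independent set of size m, and Ramsey's theorem
-- bounds it by R(n, m) =: τ. If ∣ U ∣ ≤ ∣ B ∣ then A = U works, since ∣ U ─ B ∣ ≤ ∣ B ─ U ∣.
-- Otherwise choose C with B ∩ U ⊆ C ⊆ U and ∣ C ∣ = ∣ B ∣ + 1: G[C] ∈ P by heredity, and
-- B ─ C ⊆ B ─ U.

x∈p─q⁻ : ∀ {N} (p q : Subset N) {x} → x ∈ p ─ q → x ∈ p × x ∉ q
x∈p─q⁻ (inside ∷ p) (outside ∷ q) here = here , λ ()
x∈p─q⁻ (inside ∷ p) (inside ∷ q) {fzero} ()
x∈p─q⁻ (outside ∷ p) (inside ∷ q) {fzero} ()
x∈p─q⁻ (outside ∷ p) (outside ∷ q) {fzero} ()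
x∈p─q⁻ (_ ∷ p) (_ ∷ q) (there x∈p─q) with x∈p─q⁻ p q x∈p─q
... | x∈p , x∉q = there x∈p , λ { (there x∈q) → x∉q x∈q }

p─q⊆∁q : ∀ {N} (p q : Subset N) → p ─ q ⊆ ∁ q
p─q⊆∁q p q x∈p─q = x∉p⇒x∈∁p (proj₂ (x∈p─q⁻ p q x∈p─q))

x∈p-y⁻ : ∀ {N} (p : Subset N) {x y} → x ∈ p - y → x ∈ p × x ≢ y
x∈p-y⁻ p {y = y} x∈p-y with x∈p─q⁻ p ⁅ y ⁆ x∈p-y
... | x∈p , x∉⁅y⁆ = x∈p , x∉⁅y⁆⇒x≢y x∉⁅y⁆

∣p∣≡∣p∩q∣+∣p─q∣ : ∀ {N} (p q : Subset N) → ∣ p ∣ ≡ ∣ p ∩ q ∣ + ∣ p ─ q ∣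
∣p∣≡∣p∩q∣+∣p─q∣ [] [] = refl
∣p∣≡∣p∩q∣+∣p─q∣ (inside ∷ p) (inside ∷ q) = cong suc (∣p∣≡∣p∩q∣+∣p─q∣ p q)
∣p∣≡∣p∩q∣+∣p─q∣ (inside ∷ p) (outside ∷ q) =
  trans (cong suc (∣p∣≡∣p∩q∣+∣p─q∣ p q)) (sym (+-suc _ _))
∣p∣≡∣p∩q∣+∣p─q∣ (outside ∷ p) (inside ∷ q) = ∣p∣≡∣p∩q∣+∣p─q∣ p q
∣p∣≡∣p∩q∣+∣p─q∣ (outside ∷ p) (outside ∷ q) = ∣p∣≡∣p∩q∣+∣p─q∣ p q

∣p∣≤1+∣p-x∣ : ∀ {N} (p : Subset N) x → ∣ p ∣ ≤ suc ∣ p - x ∣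
∣p∣≤1+∣p-x∣ p x = ≤-trans (≤-reflexive (∣p∣≡∣p∩q∣+∣p─q∣ p ⁅ x ⁆))
  (+-monoˡ-≤ ∣ p - x ∣ (≤-trans (∣p∩q∣≤∣q∣ p ⁅ x ⁆) (≤-reflexive (∣⁅x⁆∣≡1 x))))

∣p∣≤∣q∣⇒∣p─q∣≤∣q─p∣ : ∀ {N} (p q : Subset N) → ∣ p ∣ ≤ ∣ q ∣ → ∣ p ─ q ∣ ≤ ∣ q ─ p ∣
∣p∣≤∣q∣⇒∣p─q∣≤∣q─p∣ p q ∣p∣≤∣q∣ = +-cancelˡ-≤ ∣ p ∩ q ∣ _ _ (begin
  ∣ p ∩ q ∣ + ∣ p ─ q ∣ ≡⟨ ∣p∣≡∣p∩q∣+∣p─q∣ p q ⟨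
  ∣ p ∣                 ≤⟨ ∣p∣≤∣q∣ ⟩
  ∣ q ∣                 ≡⟨ ∣p∣≡∣p∩q∣+∣p─q∣ q p ⟩
  ∣ q ∩ p ∣ + ∣ q ─ p ∣ ≡⟨ cong (λ r → ∣ r ∣ + ∣ q ─ p ∣) (∩-comm q p) ⟩
  ∣ p ∩ q ∣ + ∣ q ─ p ∣ ∎)
  where open ≤-Reasoning

p∩q⊆r⇒p─r⊆p─q : ∀ {N} {p q r : Subset N} → p ∩ q ⊆ r → p ─ r ⊆ p ─ q
p∩q⊆r⇒p─r⊆p─q {p = p} {q} {r} p∩q⊆r x∈p─r with x∈p─q⁻ p r x∈p─r
... | x∈p , x∉r = x∈p∧x∉q⇒x∈p─q x∈p (λ x∈q → x∉r (p∩q⊆r (x∈p∩q⁺ (x∈p , x∈q))))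

nonempty⁺ : ∀ {N} (p : Subset N) → 0 < ∣ p ∣ → Nonempty p
nonempty⁺ (inside ∷ p) _ = fzero , here
nonempty⁺ (outside ∷ p) 0<∣p∣ with nonempty⁺ p 0<∣p∣
... | x , x∈p = fsuc x , there x∈p

∃-⊆-between : ∀ {N} (p q : Subset N) t → p ⊆ q → ∣ p ∣ ≤ t → t ≤ ∣ q ∣ →
  ∃ λ r → p ⊆ r × r ⊆ q × ∣ r ∣ ≡ t
∃-⊆-between [] [] zero _ _ _ = [] , (λ ()) , (λ ()) , refl
∃-⊆-between (inside ∷ p) (outside ∷ q) t p⊆q _ _ with p⊆q here
... | ()
∃-⊆-between (inside ∷ p) (inside ∷ q) (suc t) p⊆q (s≤s ∣p∣≤t) (s≤s t≤∣q∣)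
  with ∃-⊆-between p q t (drop-∷-⊆ p⊆q) ∣p∣≤t t≤∣q∣
... | r , p⊆r , r⊆q , ∣r∣≡t = inside ∷ r , in⊆in p⊆r , in⊆in r⊆q , cong suc ∣r∣≡t
∃-⊆-between (outside ∷ p) (outside ∷ q) t p⊆q ∣p∣≤t t≤∣q∣
  with ∃-⊆-between p q t (drop-∷-⊆ p⊆q) ∣p∣≤t t≤∣q∣
... | r , p⊆r , r⊆q , ∣r∣≡t = outside ∷ r , out⊆ p⊆r , out⊆ r⊆q , ∣r∣≡t
∃-⊆-between (outside ∷ p) (inside ∷ q) t p⊆q ∣p∣≤t t≤1+∣q∣ with t ≤? ∣ q ∣
... | yes t≤∣q∣ with ∃-⊆-between p q t (drop-∷-⊆ p⊆q) ∣p∣≤t t≤∣q∣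
...   | r , p⊆r , r⊆q , ∣r∣≡t = outside ∷ r , out⊆ p⊆r , out⊆ r⊆q , ∣r∣≡t
∃-⊆-between (outside ∷ p) (inside ∷ q) t p⊆q _ t≤1+∣q∣ | no t≰∣q∣ =
  inside ∷ q , out⊆ (drop-∷-⊆ p⊆q) , (λ x∈q → x∈q) , ≤-antisym (≰⇒> t≰∣q∣) t≤1+∣q∣

neighbourhood : ∀ {N} → Graph N → Fin N → Subset N
neighbourhood G v = tabulate (adj G v)

∈-neighbourhood⇒adj : ∀ {N} (G : Graph N) v {x} → x ∈ neighbourhood G v → adj G v x ≡ true
∈-neighbourhood⇒adj G v {x} x∈N = trans (sym (lookup∘tabulate (adj G v) x)) ([]=⇒lookup x∈N)

∉-neighbourhood⇒¬adj : ∀ {N} (G : Graph N) v {x} → x ∉ neighbourhood G v → adj G v x ≡ false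
∉-neighbourhood⇒¬adj G v {x} x∉N with adj G v x in v~x
... | false = refl
... | true  = ⊥-elim (x∉N (lookup⇒[]= x _ (trans (lookup∘tabulate (adj G v) x) v~x)))

record Homogeneous {N} (G : Graph N) (S : Subset N) (k : ℕ) (b : Bool) : Set where
  field
    vertex    : Fin k → Fin N
    injective : Injective _≡_ _≡_ vertex
    vertex∈S  : ∀ i → vertex i ∈ S
    adj-≢     : ∀ {i j} → i ≢ j → adj G (vertex i) (vertex j) ≡ b
open Homogeneous

homogeneous-0 : ∀ {N} (G : Graph N) S b → Homogeneous G S 0 b
homogeneous-0 G S b = record
  { vertex = λ () ; injective = λ { {()} } ; vertex∈S = λ () ; adj-≢ = λ { {()} } }

homogeneous-⊆ : ∀ {N} {G : Graph N} {S T k b} → S ⊆ T → Homogeneous G S k b → Homogeneous G T k b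
homogeneous-⊆ S⊆T h = record
  { vertex = vertex h ; injective = injective h ; vertex∈S = λ i → S⊆T (vertex∈S h i) ; adj-≢ = adj-≢ h }

homogeneous-∷ : ∀ {N} {G : Graph N} {S T k b} v → v ∈ S → T ⊆ S - v →
  (∀ {x} → x ∈ T → adj G v x ≡ b) → Homogeneous G T k b → Homogeneous G S (suc k) b
homogeneous-∷ {G = G} {S} {T} {k} {b} v v∈S T⊆S-v v~T h = record
  { vertex = vertex′ ; injective = injective′ ; vertex∈S = vertex∈S′ ; adj-≢ = adj-≢′ }
  where
  vertex′ : Fin (suc k) → Fin _
  vertex′ = v Vector.∷ vertex h
  in-S-v : ∀ i → vertex h i ∈ S × vertex h i ≢ v
  in-S-v i = x∈p-y⁻ S (T⊆S-v (vertex∈S h i))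
  injective′ : Injective _≡_ _≡_ vertex′
  injective′ {fzero}  {fzero}  _  = refl
  injective′ {fzero}  {fsuc j} eq = ⊥-elim (proj₂ (in-S-v j) (sym eq))
  injective′ {fsuc i} {fzero}  eq = ⊥-elim (proj₂ (in-S-v i) eq)
  injective′ {fsuc i} {fsuc j} eq = cong fsuc (injective h eq)
  vertex∈S′ : ∀ i → vertex′ i ∈ S
  vertex∈S′ fzero    = v∈S
  vertex∈S′ (fsuc i) = proj₁ (in-S-v i)
  adj-≢′ : ∀ {i j} → i ≢ j → adj G (vertex′ i) (vertex′ j) ≡ b
  adj-≢′ {fzero}  {fzero}  i≢j = ⊥-elim (i≢j refl)
  adj-≢′ {fzero}  {fsuc j} _   = v~T (vertex∈S h j)
  adj-≢′ {fsuc i} {fzero}  _   = trans (adj-sym G _ v) (v~T (vertex∈S h i))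
  adj-≢′ {fsuc i} {fsuc j} i≢j = adj-≢ h (λ i≡j → i≢j (cong fsuc i≡j))

module _ {N} (G : Graph N) (S : Subset N) (v : Fin N) where

  adjacentIn nonAdjacentIn : Subset N
  adjacentIn    = (S - v) ∩ neighbourhood G v
  nonAdjacentIn = (S - v) ─ neighbourhood G v

  adjacentIn⊆S-v : adjacentIn ⊆ S - v
  adjacentIn⊆S-v = p∩q⊆p (S - v) (neighbourhood G v)

  nonAdjacentIn⊆S-v : nonAdjacentIn ⊆ S - v
  nonAdjacentIn⊆S-v x∈ = proj₁ (x∈p─q⁻ (S - v) (neighbourhood G v) x∈)

  adj-adjacentIn : ∀ {x} → x ∈ adjacentIn → adj G v x ≡ true
  adj-adjacentIn x∈ = ∈-neighbourhood⇒adj G v (p∩q⊆q (S - v) (neighbourhood G v) x∈)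

  adj-nonAdjacentIn : ∀ {x} → x ∈ nonAdjacentIn → adj G v x ≡ false
  adj-nonAdjacentIn x∈ = ∉-neighbourhood⇒¬adj G v (proj₂ (x∈p─q⁻ (S - v) (neighbourhood G v) x∈))

  ∣S∣≤1+∣adjacentIn∣+∣nonAdjacentIn∣ : ∣ S ∣ ≤ suc (∣ adjacentIn ∣ + ∣ nonAdjacentIn ∣)
  ∣S∣≤1+∣adjacentIn∣+∣nonAdjacentIn∣ =
    ≤-trans (∣p∣≤1+∣p-x∣ S v) (s≤s (≤-reflexive (∣p∣≡∣p∩q∣+∣p─q∣ (S - v) (neighbourhood G v))))

a+b≤x+y∧a≰x⇒b≤y : ∀ {a b x y} → a + b ≤ x + y → ¬ a ≤ x → b ≤ y
a+b≤x+y∧a≰x⇒b≤y {a} {b} {x} {y} a+b≤x+y a≰x with b ≤? y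
... | yes b≤y = b≤y
... | no  b≰y = ⊥-elim (<-irrefl refl (≤-trans (+-mono-< (≰⇒> a≰x) (≰⇒> b≰y)) a+b≤x+y))

-- The Erdős–Szekeres upper bound for the Ramsey number R(n, m).
R : ℕ → ℕ → ℕ
R zero    m       = 0
R (suc n) zero    = 0
R (suc n) (suc m) = suc (R n (suc m) + R (suc n) m)

-- Pick v ∈ S: either R(n-1, m) vertices of S - v are adjacent to v, or R(n, m-1) are not.
ramsey : ∀ {N} (G : Graph N) n m (S : Subset N) → R n m ≤ ∣ S ∣ →
  Homogeneous G S n true ⊎ Homogeneous G S m false
ramsey G zero    m       S _ = inj₁ (homogeneous-0 G S true)
ramsey G (suc n) zero    S _ = inj₂ (homogeneous-0 G S false)
ramsey G (suc n) (suc m) S R≤∣S∣ with nonempty⁺ S (≤-trans (s≤s z≤n) R≤∣S∣)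
... | v , v∈S with R n (suc m) ≤? ∣ adjacentIn G S v ∣
...   | yes R≤∣Adj∣ with ramsey G n (suc m) (adjacentIn G S v) R≤∣Adj∣
...     | inj₁ clique = inj₁ (homogeneous-∷ v v∈S (adjacentIn⊆S-v G S v) (adj-adjacentIn G S v) clique)
...     | inj₂ indep  = inj₂ (homogeneous-⊆ (p─q⊆p S ⁅ v ⁆ ∘ adjacentIn⊆S-v G S v) indep)
ramsey G (suc n) (suc m) S R≤∣S∣ | v , v∈S | no R≰∣Adj∣
  with ramsey G (suc n) m (nonAdjacentIn G S v)
         (a+b≤x+y∧a≰x⇒b≤y (s≤s⁻¹ (≤-trans R≤∣S∣ (∣S∣≤1+∣adjacentIn∣+∣nonAdjacentIn∣ G S v))) R≰∣Adj∣)
... | inj₁ clique = inj₁ (homogeneous-⊆ (p─q⊆p S ⁅ v ⁆ ∘ nonAdjacentIn⊆S-v G S v) clique)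
... | inj₂ indep  = inj₂ (homogeneous-∷ v v∈S (nonAdjacentIn⊆S-v G S v) (adj-nonAdjacentIn G S v) indep)

K-adj-≢ : ∀ {n} {i j : Fin n} → i ≢ j → adj (K n) i j ≡ true
K-adj-≢ {i = i} {j} i≢j with i ≟ j
... | yes i≡j = ⊥-elim (i≢j i≡j)
... | no  _   = refl

homogeneous⇒InducedEmbedding : ∀ {N k b} {G : Graph N} {S} (Y : Graph k) →
  (∀ {i j} → i ≢ j → adj Y i j ≡ b) → (h : Homogeneous G S k b) → InducedEmbedding Y G (vertex h)
homogeneous⇒InducedEmbedding {G = G} Y Y-adj-≢ h = injective h , adj-≡
  where
  adj-≡ : ∀ i j → adj Y i j ≡ adj G (vertex h i) (vertex h j)
  adj-≡ i j with i ≟ j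
  ... | yes refl = trans (adj-irr Y i) (sym (adj-irr G (vertex h i)))
  ... | no  i≢j  = trans (Y-adj-≢ i≢j) (sym (adj-≢ h i≢j))

ContainsInduced-refl : ∀ {k} (Y : Graph k) → ContainsInduced Y Y
ContainsInduced-refl Y = id , id , λ _ _ → refl

pullback : ∀ {k N} → Graph N → (Fin k → Fin N) → Graph k
pullback G e = record
  { adj     = λ i j → adj G (e i) (e j)
  ; adj-sym = λ i j → adj-sym G (e i) (e j)
  ; adj-irr = λ i → adj-irr G (e i)
  }

record Enumeration {N} (S : Subset N) : Set where
  field
    element   : Fin ∣ S ∣ → Fin N
    injective : Injective _≡_ _≡_ element
    image     : ∀ x → x ∈ S ⇔ ∃ λ i → element i ≡ x
open Enumeration

enumerate : ∀ {N} (S : Subset N) → Enumeration S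
enumerate [] = record { element = λ () ; injective = λ { {()} } ; image = λ () }
enumerate (inside ∷ S) = record
  { element = element′ ; injective = injective′ ; image = λ x → mk⇔ (to x) (from x) }
  where
  E = enumerate S
  element′ : Fin (suc ∣ S ∣) → Fin _
  element′ = fzero Vector.∷ (fsuc ∘ element E)
  injective′ : Injective _≡_ _≡_ element′
  injective′ {fzero}  {fzero}  _  = refl
  injective′ {fzero}  {fsuc _} ()
  injective′ {fsuc _} {fzero}  ()
  injective′ {fsuc i} {fsuc j} eq = cong fsuc (injective E (suc-injective eq))
  to : ∀ x → x ∈ inside ∷ S → ∃ λ i → element′ i ≡ x
  to fzero    here      = fzero , refl
  to (fsuc x) (there x∈S) with Equivalence.to (image E x) x∈S
  ... | i , eᵢ≡x = fsuc i , cong fsuc eᵢ≡x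
  from : ∀ x → (∃ λ i → element′ i ≡ x) → x ∈ inside ∷ S
  from _ (fzero  , refl) = here
  from _ (fsuc i , refl) = there (Equivalence.from (image E (element E i)) (i , refl))
enumerate (outside ∷ S) = record
  { element = fsuc ∘ element E ; injective = injective E ∘ suc-injective ; image = λ x → mk⇔ (to x) (from x) }
  where
  E = enumerate S
  to : ∀ x → x ∈ outside ∷ S → ∃ λ i → fsuc (element E i) ≡ x
  to (fsuc x) (there x∈S) with Equivalence.to (image E x) x∈S
  ... | i , eᵢ≡x = i , cong fsuc eᵢ≡x
  from : ∀ x → (∃ λ i → fsuc (element E i) ≡ x) → x ∈ outside ∷ S
  from _ (i , refl) = there (Equivalence.from (image E (element E i)) (i , refl))

-- The embedding g of Y factors through the embedding f of the witness H for G[S] ∈ P.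
InducedIn-embedding⇒∈ : ∀ {P : GraphClass} {N k} {S} {Y : Graph k} {g} → Hereditary P → (G : Graph N) →
  InducedIn P G S → InducedEmbedding Y G g → (∀ i → g i ∈ S) → P Y
InducedIn-embedding⇒∈ {Y = Y} {g} her G (_ , H , f , (f-inj , f-adj) , image , PH) (g-inj , g-adj) g∈S =
  her Y H h (h-inj , h-adj) PH
  where
  h : _ → _
  h i = proj₁ (Equivalence.to (image (g i)) (g∈S i))
  f∘h≗g : ∀ i → f (h i) ≡ g i
  f∘h≗g i = proj₂ (Equivalence.to (image (g i)) (g∈S i))
  h-inj : Injective _≡_ _≡_ h
  h-inj {i} {j} hᵢ≡hⱼ = g-inj (trans (sym (f∘h≗g i)) (trans (cong f hᵢ≡hⱼ) (f∘h≗g j)))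
  h-adj : ∀ i j → adj Y i j ≡ adj H (h i) (h j)
  h-adj i j = begin
    adj Y i j                 ≡⟨ g-adj i j ⟩
    adj G (g i) (g j)         ≡⟨ cong₂ (adj G) (f∘h≗g i) (f∘h≗g j) ⟨
    adj G (f (h i)) (f (h j)) ≡⟨ f-adj (h i) (h j) ⟨
    adj H (h i) (h j)         ∎
    where open ≡-Reasoning

InducedIn-⊆ : ∀ {P : GraphClass} {N} {U C} → Hereditary P → (G : Graph N) →
  InducedIn P G U → C ⊆ U → InducedIn P G C
InducedIn-⊆ {C = C} her G G[U]∈P C⊆U =
  ∣ C ∣ , pullback G (element E) , element E , embedding , image E ,
  InducedIn-embedding⇒∈ her G G[U]∈P embedding (λ i → C⊆U (element∈C i))
  where
  E = enumerate C
  embedding : InducedEmbedding (pullback G (element E)) G (element E)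
  embedding = injective E , λ _ _ → refl
  element∈C : ∀ i → element E i ∈ C
  element∈C i = Equivalence.from (image E (element E i)) (i , refl)

∣S∣<R : ∀ {n m} {P Q : GraphClass} {N} {S} →
  Hereditary P → P ⊆C Free (K n) → Hereditary Q → Q ⊆C Free (Edgeless m) → (G : Graph N) →
  InducedIn P G S → InducedIn Q G S → ∣ S ∣ < R n m
∣S∣<R {n} {m} {P} {Q} {S = S} herP freeP herQ freeQ G G[S]∈P G[S]∈Q with R n m ≤? ∣ S ∣
... | no R≰∣S∣ = ≰⇒> R≰∣S∣
... | yes R≤∣S∣ with ramsey G n m S R≤∣S∣
...   | inj₁ clique = ⊥-elim (freeP (K n) P-Kn (ContainsInduced-refl (K n)))
  where
  P-Kn : P (K n)
  P-Kn = InducedIn-embedding⇒∈ herP G G[S]∈P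
    (homogeneous⇒InducedEmbedding (K n) K-adj-≢ clique) (vertex∈S clique)
...   | inj₂ indep = ⊥-elim (freeQ (Edgeless m) Q-Em (ContainsInduced-refl (Edgeless m)))
  where
  Q-Em : Q (Edgeless m)
  Q-Em = InducedIn-embedding⇒∈ herQ G G[S]∈Q
    (homogeneous⇒InducedEmbedding (Edgeless m) (λ _ → refl) indep) (vertex∈S indep)

∃-larger-InducedIn : ∀ {P : GraphClass} {N} {U B : Subset N} → Hereditary P → (G : Graph N) →
  InducedIn P G U → ∣ B ∣ < ∣ U ∣ → ∃ λ C → InducedIn P G C × ∣ C ∣ ≡ suc ∣ B ∣ × B ─ C ⊆ B ─ U
∃-larger-InducedIn {U = U} {B} her G G[U]∈P ∣B∣<∣U∣
  with ∃-⊆-between (B ∩ U) U (suc ∣ B ∣) (p∩q⊆q B U) (≤-trans (∣p∩q∣≤∣p∣ B U) (n≤1+n _)) ∣B∣<∣U∣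
... | C , B∩U⊆C , C⊆U , ∣C∣≡1+∣B∣ = C , InducedIn-⊆ her G G[U]∈P C⊆U , ∣C∣≡1+∣B∣ , p∩q⊆r⇒p─r⊆p─q B∩U⊆C

lemma1 : (n m : ℕ) → 1 ≤ n → 1 ≤ m → (P Q : GraphClass) →
    Hereditary P → P ⊆C Free (K n) → Hereditary Q → Q ⊆C Free (Edgeless m) →
    Σ ℕ λ τ → ∀ {N} (G : Graph N) → (P ∘C Q) G →
      (B : Subset N) → InducedIn P G B →
      (∃ λ A → InducedIn P G A × InducedIn Q G (∁ A) × ∣ A ─ B ∣ ≤ τ)
      ⊎ (∃ λ C → InducedIn P G C × ∣ C ∣ ≡ suc ∣ B ∣ × ∣ B ─ C ∣ ≤ τ)
lemma1 n m _ _ P Q herP freeP herQ freeQ = R n m , dichotomy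
  where
  dichotomy : ∀ {N} (G : Graph N) → (P ∘C Q) G → (B : Subset N) → InducedIn P G B →
    (∃ λ A → InducedIn P G A × InducedIn Q G (∁ A) × ∣ A ─ B ∣ ≤ R n m)
    ⊎ (∃ λ C → InducedIn P G C × ∣ C ∣ ≡ suc ∣ B ∣ × ∣ B ─ C ∣ ≤ R n m)
  dichotomy G (U , G[U]∈P , G[∁U]∈Q) B G[B]∈P = Sum.map take-U extend-B (≤-<-connex ∣ U ∣ ∣ B ∣)
    where
    ∣B─U∣≤R : ∣ B ─ U ∣ ≤ R n m
    ∣B─U∣≤R = <⇒≤ (∣S∣<R herP freeP herQ freeQ G
      (InducedIn-⊆ herP G G[B]∈P (p─q⊆p B U)) (InducedIn-⊆ herQ G G[∁U]∈Q (p─q⊆∁q B U)))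
    take-U : ∣ U ∣ ≤ ∣ B ∣ → ∃ λ A → InducedIn P G A × InducedIn Q G (∁ A) × ∣ A ─ B ∣ ≤ R n m
    take-U ∣U∣≤∣B∣ = U , G[U]∈P , G[∁U]∈Q , ≤-trans (∣p∣≤∣q∣⇒∣p─q∣≤∣q─p∣ U B ∣U∣≤∣B∣) ∣B─U∣≤R
    extend-B : ∣ B ∣ < ∣ U ∣ → ∃ λ C → InducedIn P G C × ∣ C ∣ ≡ suc ∣ B ∣ × ∣ B ─ C ∣ ≤ R n m
    extend-B ∣B∣<∣U∣ with ∃-larger-InducedIn {B = B} herP G G[U]∈P ∣B∣<∣U∣
    ... | C , G[C]∈P , ∣C∣≡1+∣B∣ , B─C⊆B─U =
      C , G[C]∈P , ∣C∣≡1+∣B∣ , ≤-trans (p⊆q⇒∣p∣≤∣q∣ B─C⊆B─U) ∣B─U∣≤R
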